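{- Let $(E,f,S)$ be a (possibly incoherent) partial Dowling geometry of rank $r$. Let $s\in S$, let $1\le i\le r$, and let $1\le j,k\le r$ be distinct indices (not necessarily distinct from $i$). If $s_{j,k}\in E$ then $f(b_{i},s_{j,k})=2$.
   Context: A polymatroid is $(E,f)$ with $f:\mathcal{P}(E)\to\mathbb{R}$, $f(\emptyset)=0$, monotone, submodular (and of finite type, $f(S)=\sup_{F\subseteq S\text{ finite}}f(F)$, if $E$ is infinite); $f(a_1,\dots,a_k):=f(\{a_1,\dots,a_k\})$ and $\mathrm{cl}(A)=\{x\in E\mid f(A\cup\{x\})=f(A)\}$. A partial Dowling geometry (PDG) of rank $r$ is a triple $(E,f,S)$ where $(E,f)$ is a polymatroid and: (1) $S$ is a set with an involution $s\mapsto s^{ -1}$ and a distinguished element $e$ with $e^{ -1}=e$; (2) $E$ contains $B=\{b_1,\ldots,b_r\}$ with $f(A)=|A|$ for all $A\subseteq B$; (3) for each $1\le i<j\le r$, $E$ contains a copy $\{s_{i,j}\mid s\in S\}$ of $S$, these copies pairwise disjoint and disjoint from $B$, and $E=B\sqcup\bigsqcup_{i<j}\{s_{i,j}\mid s\in S\}$; one sets $s_{i,j}^{ -1}:=(s^{ -1})_{i,j}$, and for $i<j$, $s_{j,i}:=s_{i,j}^{ -1}$ and $s_{j,i}^{ -1}:=s_{i,j}$; (4) $s_{i,j}\in\mathrm{cl}(b_i,b_j)$ for all distinct $i,j$; (5) $f(s_{i,j})=1$ and $f(b_i,s_{i,j})=2$ for all $s\in S$ and distinct $i,j$; (6) $f(s_{i,j},s^{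 -1}_{j,k},e_{k,i})=2$ for all $s\in S$ and distinct $i,j,k$. An incoherent PDG is a triple satisfying all these except (3) and (6); instead of (3) one only requires $B\subseteq E\subseteq B\sqcup\bigsqcup_{i<j}\{s_{i,j}\mid s\in S\}$, with (4),(5) required only for those $s_{i,j}$ lying in $E$. "Possibly incoherent PDG" means a PDG or an incoherent PDG. -}

module Defs where

open import Level using (0ℓ)
open import Data.Nat using (ℕ; zero; suc)
open import Data.Fin using (Fin; _<_)
open import Data.Fin.Properties using (<-cmp)
import Data.Fin.Subset as FS
open import Data.Product using (Σ; ∃; _×_; _,_; proj₁)
open import Data.Sum using (_⊎_; inj₁; inj₂)
open import Data.List using (List)
open import Data.List.Membership.Propositional using (_∈_)
open import Data.Empty using (⊥; ⊥-elim)
open import Relation.Nullary using (¬_)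
open import Relation.Unary using (Pred; _⊆_; _∪_; _∩_; ∅)
open import Relation.Binary.Definitions using (tri<; tri≈; tri>)
open import Relation.Binary.PropositionalEquality using (_≡_; _≢_)

record RealNumbers : Set₁ where
  infixl 6 _+_
  infixl 7 _*_
  infix 4 _≤_
  field
    ℝ      : Set
    0# 1#  : ℝ
    _+_ _*_ : ℝ → ℝ → ℝ
    -_     : ℝ → ℝ
    _≤_    : ℝ → ℝ → Set
    +-assoc   : ∀ x y z → (x + y) + z ≡ x + (y + z)
    +-comm    : ∀ x y → x + y ≡ y + x
    +-identityˡ : ∀ x → 0# + x ≡ x
    -‿inverseˡ : ∀ x → (- x) + x ≡ 0#
    *-assoc   : ∀ x y z → (x * y) * z ≡ x * (y * z)
    *-comm    : ∀ x y → x * y ≡ y * x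
    *-identityˡ : ∀ x → 1# * x ≡ x
    distribˡ  : ∀ x y z → x * (y + z) ≡ (x * y) + (x * z)
    0≢1       : 0# ≢ 1#
    *-inverse : ∀ x → x ≢ 0# → Σ ℝ (λ y → y * x ≡ 1#)
    ≤-refl    : ∀ x → x ≤ x
    ≤-trans   : ∀ {x y z} → x ≤ y → y ≤ z → x ≤ z
    ≤-antisym : ∀ {x y} → x ≤ y → y ≤ x → x ≡ y
    ≤-total   : ∀ x y → x ≤ y ⊎ y ≤ x
    +-mono-≤  : ∀ {x y} z → x ≤ y → x + z ≤ y + z
    *-pos     : ∀ {x y} → 0# ≤ x → 0# ≤ y → 0# ≤ x * y
    complete  : (P : Pred ℝ 0ℓ) → (∃ λ x → P x) →
                (∃ λ u → ∀ x → P x → x ≤ u) →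
                ∃ λ s → (∀ x → P x → x ≤ s) × (∀ u → (∀ x → P x → x ≤ u) → s ≤ u)

  fromℕ : ℕ → ℝ
  fromℕ zero    = 0#
  fromℕ (suc n) = 1# + fromℕ n

listSet : {E : Set} → List E → Pred E 0ℓ
listSet L = λ x → x ∈ L

IsSup : (R : RealNumbers) → Pred (RealNumbers.ℝ R) 0ℓ → RealNumbers.ℝ R → Set
IsSup R V v = (∀ x → V x → x ≤ v) × (∀ u → (∀ x → V x → x ≤ u) → v ≤ u)
  where open RealNumbers R

record Polymatroid (R : RealNumbers) (E : Set) : Set₁ where
  open RealNumbers R
  field
    f          : Pred E 0ℓ → ℝ
    f-empty    : f ∅ ≡ 0#
    monotone   : ∀ {A B} → A ⊆ B → f A ≤ f B
    submodular : ∀ A B → f (A ∪ B) + f (A ∩ B) ≤ f A + f B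
    finiteType : ∀ S → IsSup R (λ v → ∃ λ (L : List E) → listSet L ⊆ S × v ≡ f (listSet L)) (f S)

  cl : Pred E 0ℓ → Pred E 0ℓ
  cl A x = f (A ∪ (λ y → y ≡ x)) ≡ f A

-- The ambient labelled set  B ⊔ ⨆_{i<j} {s_{i,j} | s ∈ S}.
-- b i  is b_i ; el i j p s  is s_{i,j} (for i < j).

data Elt (r : ℕ) (S : Set) : Set where
  b  : Fin r → Elt r S
  el : (i j : Fin r) → i < j → S → Elt r S

-- s_{j,k} for arbitrary distinct j, k, using s_{j,k} := (s⁻¹)_{k,j} when j > k
sel : {r : ℕ} {S : Set} → (S → S) → S → (j k : Fin r) → j ≢ k → Elt r S
sel inv s j k j≢k with <-cmp j k
... | tri< j<k _ _ = el j k j<k s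
... | tri≈ _ j≡k _ = ⊥-elim (j≢k j≡k)
... | tri> _ _ k<j = el k j k<j (inv s)

-- Incoherent partial Dowling geometries: axioms (1),(2),(4),(5), with
-- B ⊆ E ⊆ B ⊔ ⨆ copies of S.

record IncoherentPDG (R : RealNumbers) (r : ℕ) (S : Set) : Set₁ where
  open RealNumbers R
  field
    inv     : S → S
    inv-inv : ∀ s → inv (inv s) ≡ s
    e       : S
    inv-e   : inv e ≡ e
    inE     : Elt r S → Set
    B⊆E     : ∀ i → inE (b i)
    poly    : Polymatroid R (Σ (Elt r S) inE)
  open Polymatroid poly public

  ⟦_⟧ : List (Elt r S) → Pred (Σ (Elt r S) inE) 0ℓ
  ⟦ L ⟧ x = proj₁ x ∈ L

  field
    B-free : ∀ (A : FS.Subset r) →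
             f (λ x → ∃ λ i → i FS.∈ A × proj₁ x ≡ b i) ≡ fromℕ (FS.∣ A ∣)
    in-cl  : ∀ s j k (j≢k : j ≢ k) (m : inE (sel inv s j k j≢k)) →
             cl ⟦ Data.List.[ b j ] Data.List.++ Data.List.[ b k ] ⟧ (sel inv s j k j≢k , m)
    rank-el : ∀ s j k (j≢k : j ≢ k) → inE (sel inv s j k j≢k) →
              f ⟦ Data.List.[ sel inv s j k j≢k ] ⟧ ≡ 1#
    rank-b-el : ∀ s j k (j≢k : j ≢ k) → inE (sel inv s j k j≢k) →
                f ⟦ Data.List.[ b j ] Data.List.++ Data.List.[ sel inv s j k j≢k ] ⟧ ≡ 1# + 1#

record PDG (R : RealNumbers) (r : ℕ) (S : Set) : Set₁ where
  field
    core : IncoherentPDG R r S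
  open IncoherentPDG core
  open RealNumbers R
  field
    E-all : ∀ x → inE x
    triangle : ∀ s i j k (i≢j : i ≢ j) (j≢k : j ≢ k) (k≢i : k ≢ i) →
               f ⟦ Data.List.[ sel inv s i j i≢j ] Data.List.++
                   Data.List.[ sel inv (inv s) j k j≢k ] Data.List.++
                   Data.List.[ sel inv e k i k≢i ] ⟧ ≡ 1# + 1#

PossiblyIncoherentPDG : (R : RealNumbers) (r : ℕ) (S : Set) → Set₁
PossiblyIncoherentPDG R r S = PDG R r S ⊎ IncoherentPDG R r S

underlying : {R : RealNumbers} {r : ℕ} {S : Set} →
             PossiblyIncoherentPDG R r S → IncoherentPDG R r S
underlying (inj₁ G) = PDG.core G
underlying (inj₂ G) = G

{-# OPTIONS --safe #-}
module Submission where

open import Defs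
open import Data.Nat using (ℕ; suc)
open import Data.Fin using (Fin; zero; suc)
open import Data.List using (List; []; _∷_; [_]; _++_)
open import Relation.Binary.PropositionalEquality using (_≡_; _≢_; refl; sym; trans; cong; cong₂; subst; subst₂; module ≡-Reasoning)

open import Level using (0ℓ)
open import Function using (_∘_)
open import Data.Empty using (⊥-elim)
open import Data.Product using (∃; Σ; _×_; _,_; proj₁; proj₂)
open import Data.Sum using (inj₁; inj₂)
open import Data.Fin.Properties using (<-cmp; <-irrelevant; <-asym; _≟_)
import Data.Fin.Subset as Sub
open import Data.Fin.Subset using (Subset; inside; outside; ⁅_⁆; ∣_∣; _∉_)
open import Data.Fin.Subset.Properties using (x∈⁅x⁆; x∈⁅y⁆⇒x≡y; ∣⁅x⁆∣≡1; x∈p∪q⁺; x∈p∪q⁻; ∪-identityʳ)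
open import Data.Vec.Base as Vec using (_∷_)
open import Data.List.Relation.Unary.Any using (here; there)
open import Relation.Nullary using (yes; no)
open import Relation.Unary using (Pred; _⊆_; _∪_; _∩_)
open import Relation.Binary.Definitions using (tri<; tri≈; tri>)

-- If i is j or k this is axiom (5), after writing s_{j,k} = (s⁻¹)_{k,j} when i = k.
-- Otherwise f(b_i, s_{j,k}) ≤ f(b_i) + f(s_{j,k}) = 2, and submodularity for
-- A = {b_i, s_{j,k}} and Z = {b_j, b_k, s_{j,k}} gives
-- f(A) + f(Z) ≥ f(b_i, b_j, b_k) + f(s_{j,k}) = 4, while f(Z) = f(b_j, b_k) = 2
-- because s_{j,k} ∈ cl(b_j, b_k).

module RealNumberProperties (R : RealNumbers) where
  open RealNumbers R

  2# : ℝ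
  2# = 1# + 1#

  +-identityʳ : ∀ x → x + 0# ≡ x
  +-identityʳ x = trans (+-comm x 0#) (+-identityˡ x)

  ≤-reflexive : ∀ {x y} → x ≡ y → x ≤ y
  ≤-reflexive {x} refl = ≤-refl x

  +-monoʳ-≤ : ∀ {x y} z → x ≤ y → z + x ≤ z + y
  +-monoʳ-≤ {x} {y} z x≤y = subst₂ _≤_ (+-comm x z) (+-comm y z) (+-mono-≤ z x≤y)

  +-mono₂-≤ : ∀ {x y u v} → x ≤ y → u ≤ v → x + u ≤ y + v
  +-mono₂-≤ {y = y} {u = u} x≤y u≤v = ≤-trans (+-mono-≤ u x≤y) (+-monoʳ-≤ y u≤v)

  +-cancelʳ-≤ : ∀ {x y} c → x + c ≤ y + c → x ≤ y
  +-cancelʳ-≤ {x} {y} c = subst₂ _≤_ (x+c-c≡x x) (x+c-c≡x y) ∘ +-mono-≤ (- c)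
    where
    open ≡-Reasoning
    x+c-c≡x : ∀ t → (t + c) + - c ≡ t
    x+c-c≡x t = begin
      (t + c) + - c  ≡⟨ +-assoc t c (- c) ⟩
      t + (c + - c)  ≡⟨ cong (t +_) (trans (+-comm c (- c)) (-‿inverseˡ c)) ⟩
      t + 0#         ≡⟨ +-identityʳ t ⟩
      t              ∎

  fromℕ-1 : fromℕ 1 ≡ 1#
  fromℕ-1 = +-identityʳ 1#

  fromℕ-2 : fromℕ 2 ≡ 2#
  fromℕ-2 = cong (1# +_) fromℕ-1

  fromℕ-3+1 : fromℕ 3 + 1# ≡ 2# + 2#
  fromℕ-3+1 = begin
    (1# + fromℕ 2) + 1#  ≡⟨ cong (λ t → (1# + t) + 1#) fromℕ-2 ⟩
    (1# + 2#) + 1#       ≡⟨ +-assoc 1# 2# 1# ⟩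
    1# + (2# + 1#)       ≡⟨ cong (1# +_) (+-assoc 1# 1# 1#) ⟩
    1# + (1# + 2#)       ≡⟨ sym (+-assoc 1# 1# 2#) ⟩
    2# + 2#              ∎
    where open ≡-Reasoning

module PolymatroidProperties {R : RealNumbers} {E : Set} (P : Polymatroid R E) where
  open RealNumbers R
  open RealNumberProperties R
  open Polymatroid P

  f-nonneg : ∀ X → 0# ≤ f X
  f-nonneg X = subst (_≤ f X) f-empty (monotone λ ())

  f-subadditive : ∀ A B → f (A ∪ B) ≤ f A + f B
  f-subadditive A B = subst (_≤ f A + f B) (+-identityʳ (f (A ∪ B)))
    (≤-trans (+-monoʳ-≤ (f (A ∪ B)) (f-nonneg (A ∩ B))) (submodular A B))

  submodular-bound : ∀ {A Z : Pred E 0ℓ} {x y z} → x ≤ f (A ∪ Z) → y ≤ f (A ∩ Z) → f Z ≤ z →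
                     x + y ≤ f A + z
  submodular-bound {A} {Z} a≤ c≤ ≤d =
    ≤-trans (+-mono₂-≤ a≤ c≤) (≤-trans (submodular A Z) (+-monoʳ-≤ (f A) ≤d))

  f-∪-list-⊆cl : ∀ {A X : Pred E 0ℓ} (L : List E) → listSet L ⊆ A ∪ X → X ⊆ cl A →
                 f (A ∪ listSet L) ≤ f A
  f-∪-list-⊆cl [] _ _ = monotone λ { (inj₁ a) → a ; (inj₂ ()) }
  f-∪-list-⊆cl {A} {X} (x ∷ L) x∷L⊆ X⊆cl with x∷L⊆ (here refl)
  ... | inj₁ x∈A = ≤-trans (monotone L-part) IH
    where
    L-part : A ∪ listSet (x ∷ L) ⊆ A ∪ listSet L
    L-part (inj₁ a)           = inj₁ a
    L-part (inj₂ (here refl)) = inj₁ x∈A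
    L-part (inj₂ (there y∈L)) = inj₂ y∈L
    IH : f (A ∪ listSet L) ≤ f A
    IH = f-∪-list-⊆cl L (x∷L⊆ ∘ there) X⊆cl
  ... | inj₂ x∈X = ≤-trans (+-cancelʳ-≤ (f A) bound) (≤-reflexive (X⊆cl x∈X))
    where
    A+L A+x : Pred E 0ℓ
    A+L = A ∪ listSet L
    A+x = A ∪ (λ y → y ≡ x)
    split : A ∪ listSet (x ∷ L) ⊆ A+x ∪ A+L
    split (inj₁ a)           = inj₁ (inj₁ a)
    split (inj₂ (here y≡x))  = inj₁ (inj₂ y≡x)
    split (inj₂ (there y∈L)) = inj₂ (inj₂ y∈L)
    bound : f (A ∪ listSet (x ∷ L)) + f A ≤ f A+x + f A
    bound = submodular-bound (monotone split) (monotone λ a → inj₁ a , inj₁ a)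
                             (f-∪-list-⊆cl L (x∷L⊆ ∘ there) X⊆cl)

  f-∪-⊆cl : ∀ {A X : Pred E 0ℓ} → X ⊆ cl A → f (A ∪ X) ≤ f A
  f-∪-⊆cl {A} {X} X⊆cl = proj₂ (finiteType (A ∪ X)) (f A) bound
    where
    bound : ∀ v → (∃ λ L → listSet L ⊆ A ∪ X × v ≡ f (listSet L)) → v ≤ f A
    bound _ (L , L⊆ , refl) = ≤-trans (monotone inj₂) (f-∪-list-⊆cl L L⊆ X⊆cl)

∣p∪⁅x⁆∣≡1+∣p∣ : ∀ {n} (p : Subset n) {x : Fin n} → x ∉ p → ∣ p Sub.∪ ⁅ x ⁆ ∣ ≡ suc ∣ p ∣
∣p∪⁅x⁆∣≡1+∣p∣ (outside ∷ p) {zero}  _   = cong suc (cong ∣_∣ (∪-identityʳ p))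
∣p∪⁅x⁆∣≡1+∣p∣ (inside  ∷ p) {zero}  x∉p = ⊥-elim (x∉p Vec.here)
∣p∪⁅x⁆∣≡1+∣p∣ (outside ∷ p) {suc x} x∉p = ∣p∪⁅x⁆∣≡1+∣p∣ p (x∉p ∘ Vec.there)
∣p∪⁅x⁆∣≡1+∣p∣ (inside  ∷ p) {suc x} x∉p = cong suc (∣p∪⁅x⁆∣≡1+∣p∣ p (x∉p ∘ Vec.there))

sel-sym : ∀ {r} {S : Set} {inv : S → S} → (∀ s → inv (inv s) ≡ s) →
          ∀ s {j k : Fin r} (j≢k : j ≢ k) (k≢j : k ≢ j) →
          sel inv (inv s) k j k≢j ≡ sel inv s j k j≢k
sel-sym inv-inv s {j} {k} j≢k k≢j with <-cmp j k | <-cmp k j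
... | tri< j<k _ _ | tri> _ _ j<k′ = cong₂ (el j k) (<-irrelevant j<k′ j<k) (inv-inv s)
... | tri> _ _ k<j | tri< k<j′ _ _ = cong₂ (el k j) (<-irrelevant k<j′ k<j) refl
... | tri< j<k _ _ | tri< k<j _ _  = ⊥-elim (<-asym j<k k<j)
... | tri> _ _ k<j | tri> _ _ j<k  = ⊥-elim (<-asym j<k k<j)
... | tri≈ _ j≡k _ | _             = ⊥-elim (j≢k j≡k)
... | _            | tri≈ _ k≡j _  = ⊥-elim (k≢j k≡j)

module IncoherentPDGProperties {R : RealNumbers} {r : ℕ} {S : Set} (G : IncoherentPDG R r S) where
  open RealNumbers R
  open RealNumberProperties R
  open IncoherentPDG G
  open PolymatroidProperties poly

  B[_] : Subset r → Pred (Σ (Elt r S) inE) 0ℓ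
  B[ p ] x = ∃ λ i → i Sub.∈ p × proj₁ x ≡ b i

  f-b≤1 : ∀ i → f ⟦ [ b i ] ⟧ ≤ 1#
  f-b≤1 i = ≤-trans (monotone {B = B[ ⁅ i ⁆ ]} λ { (here x≡bi) → i , x∈⁅x⁆ i , x≡bi })
                    (≤-reflexive (trans (B-free ⁅ i ⁆) (trans (cong fromℕ (∣⁅x⁆∣≡1 i)) fromℕ-1)))

  f-bb≤2 : ∀ {j k} → j ≢ k → f ⟦ [ b j ] ++ [ b k ] ⟧ ≤ 2#
  f-bb≤2 {j} {k} j≢k = ≤-trans (monotone λ {x} → ⊆B[jk] {x})
                               (≤-reflexive (trans (B-free jk) (trans (cong fromℕ ∣jk∣≡2) fromℕ-2)))
    where
    jk : Subset r
    jk = ⁅ j ⁆ Sub.∪ ⁅ k ⁆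
    ⊆B[jk] : ⟦ [ b j ] ++ [ b k ] ⟧ ⊆ B[ jk ]
    ⊆B[jk] (here x≡bj)         = j , x∈p∪q⁺ (inj₁ (x∈⁅x⁆ j)) , x≡bj
    ⊆B[jk] (there (here x≡bk)) = k , x∈p∪q⁺ (inj₂ (x∈⁅x⁆ k)) , x≡bk
    ∣jk∣≡2 : ∣ jk ∣ ≡ 2
    ∣jk∣≡2 = trans (∣p∪⁅x⁆∣≡1+∣p∣ ⁅ j ⁆ (j≢k ∘ sym ∘ x∈⁅y⁆⇒x≡y j)) (cong suc (∣⁅x⁆∣≡1 j))

  f-bbb≥3 : ∀ {i j k} → i ≢ j → i ≢ k → j ≢ k → fromℕ 3 ≤ f ⟦ b i ∷ b j ∷ b k ∷ [] ⟧
  f-bbb≥3 {i} {j} {k} i≢j i≢k j≢k =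
    ≤-trans (≤-reflexive (sym (trans (B-free ijk) (cong fromℕ ∣ijk∣≡3)))) (monotone λ {x} → B[ijk]⊆ {x})
    where
    ij ijk : Subset r
    ij = ⁅ i ⁆ Sub.∪ ⁅ j ⁆
    ijk = ij Sub.∪ ⁅ k ⁆
    k∉ij : k ∉ ij
    k∉ij k∈ij with x∈p∪q⁻ ⁅ i ⁆ ⁅ j ⁆ k∈ij
    ... | inj₁ k∈i = i≢k (sym (x∈⁅y⁆⇒x≡y i k∈i))
    ... | inj₂ k∈j = j≢k (sym (x∈⁅y⁆⇒x≡y j k∈j))
    ∣ijk∣≡3 : ∣ ijk ∣ ≡ 3
    ∣ijk∣≡3 = trans (∣p∪⁅x⁆∣≡1+∣p∣ ij k∉ij)
                    (cong suc (trans (∣p∪⁅x⁆∣≡1+∣p∣ ⁅ i ⁆ (i≢j ∘ sym ∘ x∈⁅y⁆⇒x≡y i)) (cong suc (∣⁅x⁆∣≡1 i))))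
    B[ijk]⊆ : B[ ijk ] ⊆ ⟦ b i ∷ b j ∷ b k ∷ [] ⟧
    B[ijk]⊆ (l , l∈ijk , x≡bl) with x∈p∪q⁻ ij ⁅ k ⁆ l∈ijk
    ... | inj₂ l∈k = there (there (here (trans x≡bl (cong b (x∈⁅y⁆⇒x≡y k l∈k)))))
    ... | inj₁ l∈ij with x∈p∪q⁻ ⁅ i ⁆ ⁅ j ⁆ l∈ij
    ...   | inj₁ l∈i = here (trans x≡bl (cong b (x∈⁅y⁆⇒x≡y i l∈i)))
    ...   | inj₂ l∈j = there (here (trans x≡bl (cong b (x∈⁅y⁆⇒x≡y j l∈j))))

  rank-b-sel-distinct : ∀ s {i j k} (j≢k : j ≢ k) → i ≢ j → i ≢ k → inE (sel inv s j k j≢k) →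
                        f ⟦ [ b i ] ++ [ sel inv s j k j≢k ] ⟧ ≡ 2#
  rank-b-sel-distinct s {i} {j} {k} j≢k i≢j i≢k y∈E = ≤-antisym upper lower
    where
    y : Elt r S
    y = sel inv s j k j≢k
    A Bjk Z : Pred (Σ (Elt r S) inE) 0ℓ
    A = ⟦ [ b i ] ++ [ y ] ⟧
    Bjk = ⟦ [ b j ] ++ [ b k ] ⟧
    Z = Bjk ∪ ⟦ [ y ] ⟧

    upper : f A ≤ 2#
    upper = ≤-trans (monotone {B = ⟦ [ b i ] ⟧ ∪ ⟦ [ y ] ⟧} λ { (here e) → inj₁ (here e) ; (there e) → inj₂ e })
                    (≤-trans (f-subadditive _ _) (+-mono₂-≤ (f-b≤1 i) (≤-reflexive (rank-el s j k j≢k y∈E))))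

    -- ⟦ [ y ] ⟧ has one element for each proof of inE y, so it may be infinite;
    -- absorbing it into cl(b_j, b_k) is where finite type is needed.
    y⊆cl : ⟦ [ y ] ⟧ ⊆ cl Bjk
    y⊆cl {_ , y∈E′} (here refl) = in-cl s j k j≢k y∈E′

    f-Z≤2 : f Z ≤ 2#
    f-Z≤2 = ≤-trans (f-∪-⊆cl y⊆cl) (f-bb≤2 j≢k)

    ijk⊆A∪Z : ⟦ b i ∷ b j ∷ b k ∷ [] ⟧ ⊆ A ∪ Z
    ijk⊆A∪Z (here e)                 = inj₁ (here e)
    ijk⊆A∪Z (there (here e))         = inj₂ (inj₁ (here e))
    ijk⊆A∪Z (there (there (here e))) = inj₂ (inj₁ (there (here e)))

    y⊆A∩Z : ⟦ [ y ] ⟧ ⊆ A ∩ Z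
    y⊆A∩Z y∈ = there y∈ , inj₂ y∈

    lower : 2# ≤ f A
    lower = +-cancelʳ-≤ 2# (subst (_≤ f A + 2#) fromℕ-3+1
              (submodular-bound (≤-trans (f-bbb≥3 i≢j i≢k j≢k) (monotone λ {x} → ijk⊆A∪Z {x}))
                                (≤-trans (≤-reflexive (sym (rank-el s j k j≢k y∈E))) (monotone λ {x} → y⊆A∩Z {x}))
                                f-Z≤2))

  rank-b-sel : ∀ s i j k (j≢k : j ≢ k) → inE (sel inv s j k j≢k) →
               f ⟦ [ b i ] ++ [ sel inv s j k j≢k ] ⟧ ≡ 2#
  rank-b-sel s i j k j≢k y∈E with i ≟ j | i ≟ k
  ... | yes refl | _        = rank-b-el s i k j≢k y∈E
  ... | no _     | yes refl =
    subst (λ y → inE y → f ⟦ [ b i ] ++ [ y ] ⟧ ≡ 2#)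
          (sel-sym inv-inv s j≢k (j≢k ∘ sym)) (rank-b-el (inv s) i j (j≢k ∘ sym)) y∈E
  ... | no i≢j   | no i≢k   = rank-b-sel-distinct s j≢k i≢j i≢k y∈E

lemma4p6 : (R : RealNumbers) (r : ℕ) (S : Set) (G : PossiblyIncoherentPDG R r S) →
           let open IncoherentPDG (underlying G) in
           (s : S) (i j k : Fin r) (j≢k : j ≢ k) →
           inE (sel inv s j k j≢k) →
           f ⟦ [ b i ] ++ [ sel inv s j k j≢k ] ⟧ ≡ RealNumbers._+_ R (RealNumbers.1# R) (RealNumbers.1# R)
lemma4p6 R r S G = IncoherentPDGProperties.rank-b-sel (underlying G)
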